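{- Let $\gamma$ be the morphism on $\{a,b,c\}^*$ given by $a\mapsto aca$, $b\mapsto cab$, $c\mapsto b$, and let $p_{ -1}=a^{ -1}$, $p_0=b$, $p_{k+1}=\gamma(ca\,p_k)$ for $k\ge0$. Then (i) for all $k\ge 2$, $\gamma^k(ab)=aca\,p_{k-2}\,aca\,p_{k-1}$, and this is a symmetric word with a point of symmetry at $|p_{k-2}|+5$; (ii) for all $k\ge 1$, $\gamma^k(ac)=aca\,p_{k-1}$, and this is a symmetric word with a point of symmetry at $2$.
   Context: The $p_k$ with $k\ge0$ are words (computed in the free group; e.g. $p_1=bacacab$). A word $w=w_0\cdots w_{n-1}$ ($n\ge1$) has a point of symmetry at an integer $0\le s\le n-1$ if $w_{s-i}=w_i$ for all $0\le i\le n-1$, indices taken modulo $n$; $w$ is symmetric if it has a point of symmetry (equivalently, it is a product of two palindromes). -}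

module Defs where

open import Data.Nat using (ℕ; zero; suc; _+_; _∸_; _<_)
open import Data.Nat.DivMod using (_mod_)
open import Data.Fin using (Fin; toℕ)
open import Data.List using (List; []; _∷_; _++_; length; lookup; concatMap)
open import Data.Product using (_×_; ∃)
open import Data.Empty using (⊥)
open import Relation.Binary.PropositionalEquality using (_≡_)

data Letter : Set where
  a b c : Letter

Word : Set
Word = List Letter

γ₁ : Letter → Word
γ₁ a = a ∷ c ∷ a ∷ []
γ₁ b = c ∷ a ∷ b ∷ []
γ₁ c = b ∷ []

γ : Word → Word
γ = concatMap γ₁

γ^ : ℕ → Word → Word
γ^ zero w = w
γ^ (suc k) w = γ (γ^ k w)

p : ℕ → Word
p zero = b ∷ []
p (suc k) = γ (c ∷ a ∷ p k)

-- w = w_0 … w_{n-1} (n ≥ 1) has a point of symmetry at s (0 ≤ s ≤ n-1) if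
-- w_{(s-i) mod n} = w_i for all 0 ≤ i ≤ n-1.  For i ≤ n-1 the integer
-- residue (s - i) mod n equals (s + (n ∸ i)) mod n computed in ℕ.
PointOfSymmetry : Word → ℕ → Set
PointOfSymmetry [] s = ⊥
PointOfSymmetry (x ∷ xs) s =
  s < length (x ∷ xs) ×
  ((i : Fin (length (x ∷ xs))) →
     lookup (x ∷ xs) ((s + (length (x ∷ xs) ∸ toℕ i)) mod length (x ∷ xs))
       ≡ lookup (x ∷ xs) i)

Symmetric : Word → Set
Symmetric w = ∃ λ s → PointOfSymmetry w s

-- A word P Q with P, Q palindromes and |P| = s + 1 has a point of symmetry at s:
-- the reflection i ↦ s − i (mod |PQ|) reverses P in place and reverses Q in place.
-- The words p_k are palindromes because p_{k+3} = p_{k+2} aca p_{k+1} aca p_{k+2},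
-- and by induction γ^k(ab) = (aca p_{k−2} aca) p_{k−1} and γ^k(ac) = (aca) p_{k−1},
-- each the product of a palindrome of length |p_{k−2}| + 6 (resp. 3) and a palindrome.
module Submission where

open import Defs
open import Data.Nat using (ℕ; zero; suc; _+_; _∸_; _≤_; _<_; _%_; NonZero; s≤s)
open import Data.Nat.Properties
open import Data.Nat.DivMod using (_mod_; m%n<n; m<n⇒m%n≡m; [m+n]%n≡m%n)
open import Data.Nat.Tactic.RingSolver using (solve-∀)
open import Data.Fin using (Fin; toℕ; zero; suc)
open import Data.Fin.Properties using (toℕ-fromℕ<; toℕ<n)
open import Data.List using (List; []; _∷_; _++_; length; lookup; reverse; [_])
open import Data.List.Properties using (length-++; unfold-reverse; reverse-++; ++-assoc; concatMap-++; length-reverse)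
open import Data.Maybe using (Maybe; just; nothing)
open import Data.Maybe.Properties using (just-injective)
open import Data.Product using (_×_; _,_)
open import Data.Sum using (_⊎_; inj₁; inj₂)
open import Relation.Nullary using (yes; no)
open import Relation.Binary.PropositionalEquality
  using (_≡_; refl; sym; trans; cong; subst; module ≡-Reasoning)
open ≡-Reasoning

module _ {A : Set} where

  _!?_ : List A → ℕ → Maybe A
  []       !? _     = nothing
  (x ∷ xs) !? zero  = just x
  (x ∷ xs) !? suc i = xs !? i

  lookup-!? : (xs : List A) (i : Fin (length xs)) → xs !? toℕ i ≡ just (lookup xs i)
  lookup-!? (x ∷ xs) zero    = refl
  lookup-!? (x ∷ xs) (suc i) = lookup-!? xs i

  !?-++ˡ : ∀ xs {ys i} → i < length xs → (xs ++ ys) !? i ≡ xs !? i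
  !?-++ˡ (x ∷ xs) {i = zero}  _         = refl
  !?-++ˡ (x ∷ xs) {i = suc i} (s≤s i<n) = !?-++ˡ xs i<n

  !?-++ʳ : ∀ xs {ys} j → (xs ++ ys) !? (length xs + j) ≡ ys !? j
  !?-++ʳ []       j = refl
  !?-++ʳ (x ∷ xs) j = !?-++ʳ xs j

  reverse-!? : ∀ xs {i j} → suc (j + i) ≡ length xs → reverse xs !? i ≡ xs !? j
  reverse-!? (x ∷ xs) {i} {zero} eq = begin
    reverse (x ∷ xs) !? i                             ≡⟨ cong (_!? i) (unfold-reverse x xs) ⟩
    (reverse xs ++ [ x ]) !? i                        ≡⟨ cong ((reverse xs ++ [ x ]) !?_) i≡ ⟩
    (reverse xs ++ [ x ]) !? (length (reverse xs) + 0) ≡⟨ !?-++ʳ (reverse xs) 0 ⟩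
    just x                                            ∎
    where
    i≡ : i ≡ length (reverse xs) + 0
    i≡ = trans (suc-injective eq) (sym (trans (+-identityʳ _) (length-reverse xs)))
  reverse-!? (x ∷ xs) {i} {suc j} eq = begin
    reverse (x ∷ xs) !? i      ≡⟨ cong (_!? i) (unfold-reverse x xs) ⟩
    (reverse xs ++ [ x ]) !? i ≡⟨ !?-++ˡ (reverse xs) (subst (i <_) (sym (length-reverse xs)) i<n) ⟩
    reverse xs !? i            ≡⟨ reverse-!? xs (suc-injective eq) ⟩
    xs !? j                    ∎
    where
    i<n : i < length xs
    i<n = ≤-trans (s≤s (m≤n+m i j)) (≤-reflexive (suc-injective eq))

  Palindrome : List A → Set
  Palindrome xs = reverse xs ≡ xs

  palindrome-!? : ∀ {xs i j} → Palindrome xs → suc (i + j) ≡ length xs → xs !? i ≡ xs !? j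
  palindrome-!? {xs} {i} {j} pal eq =
    trans (cong (_!? i) (sym pal)) (reverse-!? xs (trans (cong suc (+-comm j i)) eq))

  palindrome-++-mirror : ∀ {X Y} → Palindrome X → Palindrome Y → Palindrome (X ++ Y ++ X)
  palindrome-++-mirror {X} {Y} palX palY = begin
    reverse (X ++ Y ++ X)               ≡⟨ reverse-++ X (Y ++ X) ⟩
    reverse (Y ++ X) ++ reverse X       ≡⟨ cong (_++ reverse X) (reverse-++ Y X) ⟩
    (reverse X ++ reverse Y) ++ reverse X ≡⟨ cong (λ Z → (Z ++ reverse Y) ++ Z) palX ⟩
    (X ++ reverse Y) ++ X               ≡⟨ cong (λ Z → (X ++ Z) ++ X) palY ⟩
    (X ++ Y) ++ X                       ≡⟨ ++-assoc X Y X ⟩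
    X ++ Y ++ X                         ∎

-- For i, j, s < n this says i + j ≡ s (mod n), i.e. j is the image of i under i ↦ s − i.
Mirrored : ℕ → ℕ → ℕ → ℕ → Set
Mirrored n s i j = i + j ≡ s ⊎ i + j ≡ s + n

mirrored-mod : ∀ {n s i} .{{_ : NonZero n}} → s < n → i < n → Mirrored n s i ((s + (n ∸ i)) % n)
mirrored-mod {n} {s} {i} s<n i<n with i ≤? s
... | yes i≤s = inj₁ (trans (cong (i +_) reflection≡) (m+[n∸m]≡n i≤s))
  where
  reflection≡ : (s + (n ∸ i)) % n ≡ s ∸ i
  reflection≡ = begin
    (s + (n ∸ i)) % n ≡⟨ cong (_% n) (sym (+-∸-assoc s (<⇒≤ i<n))) ⟩
    (s + n ∸ i) % n   ≡⟨ cong (_% n) (+-∸-comm n i≤s) ⟩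
    (s ∸ i + n) % n   ≡⟨ [m+n]%n≡m%n (s ∸ i) n ⟩
    (s ∸ i) % n       ≡⟨ m<n⇒m%n≡m (≤-<-trans (m∸n≤m s i) s<n) ⟩
    s ∸ i             ∎
... | no i≰s = inj₂ (trans (cong (i +_) (m<n⇒m%n≡m reflection<n)) (begin
    i + (s + (n ∸ i)) ≡⟨ sym (+-assoc i s (n ∸ i)) ⟩
    i + s + (n ∸ i)   ≡⟨ cong (_+ (n ∸ i)) (+-comm i s) ⟩
    s + i + (n ∸ i)   ≡⟨ +-assoc s i (n ∸ i) ⟩
    s + (i + (n ∸ i)) ≡⟨ cong (s +_) (m+[n∸m]≡n (<⇒≤ i<n)) ⟩
    s + n             ∎))
  where
  reflection<n : s + (n ∸ i) < n
  reflection<n = <-≤-trans (+-monoˡ-< (n ∸ i) (≰⇒> i≰s)) (≤-reflexive (m+[n∸m]≡n (<⇒≤ i<n)))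

pointOfSymmetry-intro : ∀ w {s} → s < length w →
  (∀ {i j} → i < length w → j < length w → Mirrored (length w) s i j → w !? i ≡ w !? j) →
  PointOfSymmetry w s
pointOfSymmetry-intro (x ∷ xs) {s} s<n mirror = s<n , λ i → just-injective (begin
    just (lookup w (reflect i mod n)) ≡⟨ sym (lookup-!? w (reflect i mod n)) ⟩
    w !? toℕ (reflect i mod n)        ≡⟨ cong (w !?_) (toℕ-fromℕ< (m%n<n (reflect i) n)) ⟩
    w !? (reflect i % n)              ≡⟨ sym (mirror (toℕ<n i) (m%n<n (reflect i) n) (mirrored-mod s<n (toℕ<n i))) ⟩
    w !? toℕ i                        ≡⟨ lookup-!? w i ⟩
    just (lookup w i)                 ∎)
  where
  w = x ∷ xs
  n = length w
  reflect : Fin n → ℕ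
  reflect i = s + (n ∸ toℕ i)

mirrored-suffix : ∀ {s L q i j} → L ≡ suc s → L + i + (L + j) ≡ s + (L + q) → suc (i + j) ≡ q
mirrored-suffix {s} {q = q} {i} {j} refl eq =
  +-cancelˡ-≡ (s + suc s) _ _ (trans (regroup s i j) (trans eq (sym (+-assoc s (suc s) q))))
  where
  regroup : ∀ s i j → s + suc s + suc (i + j) ≡ suc s + i + (suc s + j)
  regroup = solve-∀

pointOfSymmetry-++ : ∀ {P Q : Word} {s} → Palindrome P → Palindrome Q → length P ≡ suc s →
  PointOfSymmetry (P ++ Q) s
pointOfSymmetry-++ {P} {Q} {s} palP palQ |P|≡ =
  pointOfSymmetry-intro (P ++ Q) s<n mirror
  where
  L = length P
  n = length (P ++ Q)
  |PQ|≡ : n ≡ L + length Q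
  |PQ|≡ = length-++ P
  s<n : s < n
  s<n = ≤-trans (≤-trans (≤-reflexive (sym |P|≡)) (m≤m+n L (length Q))) (≤-reflexive (sym |PQ|≡))
  beyond : ∀ {i j} → i + j ≡ s + n → j < n → L ≤ i
  beyond {i} {j} eq j<n = subst (_≤ i) (sym |P|≡) (≰⇒> λ i≤s → <-irrefl eq (+-mono-≤-< i≤s j<n))
  mirror : ∀ {i j} → i < n → j < n → Mirrored n s i j → (P ++ Q) !? i ≡ (P ++ Q) !? j
  mirror {i} {j} _ _ (inj₁ eq) = begin
    (P ++ Q) !? i ≡⟨ !?-++ˡ P (inP i (m+n≤o⇒m≤o i (≤-reflexive eq))) ⟩
    P !? i        ≡⟨ palindrome-!? palP (trans (cong suc eq) (sym |P|≡)) ⟩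
    P !? j        ≡⟨ sym (!?-++ˡ P (inP j (m+n≤o⇒n≤o i (≤-reflexive eq)))) ⟩
    (P ++ Q) !? j ∎
    where
    inP : ∀ k → k ≤ s → k < L
    inP k k≤s = ≤-trans (s≤s k≤s) (≤-reflexive (sym |P|≡))
  mirror {i} {j} i<n j<n (inj₂ eq)
    with m≤n⇒∃[o]m+o≡n (beyond {i} eq j<n) | m≤n⇒∃[o]m+o≡n (beyond {j} (trans (+-comm j i) eq) i<n)
  ... | i′ , refl | j′ , refl = begin
    (P ++ Q) !? (L + i′) ≡⟨ !?-++ʳ P i′ ⟩
    Q !? i′              ≡⟨ palindrome-!? palQ (mirrored-suffix |P|≡ (trans eq (cong (s +_) |PQ|≡))) ⟩
    Q !? j′              ≡⟨ sym (!?-++ʳ P j′) ⟩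
    (P ++ Q) !? (L + j′) ∎

aca : Word
aca = a ∷ c ∷ a ∷ []

γ-++ : ∀ xs ys → γ (xs ++ ys) ≡ γ xs ++ γ ys
γ-++ = concatMap-++ γ₁

γ-sandwich : ∀ X Y → γ (X ++ aca ++ Y ++ aca ++ X) ≡ γ X ++ aca ++ b ∷ aca ++ γ Y ++ aca ++ b ∷ aca ++ γ X
γ-sandwich X Y = begin
  γ (X ++ aca ++ Y ++ aca ++ X)              ≡⟨ γ-++ X (aca ++ Y ++ aca ++ X) ⟩
  γ X ++ aca ++ b ∷ aca ++ γ (Y ++ aca ++ X) ≡⟨ cong (λ Z → γ X ++ aca ++ b ∷ aca ++ Z) (γ-++ Y (aca ++ X)) ⟩
  γ X ++ aca ++ b ∷ aca ++ γ Y ++ aca ++ b ∷ aca ++ γ X ∎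

-- p (suc k) reduces to b ∷ aca ++ γ (p k), and γ aca reduces to aca ++ b ∷ aca.
p-unfold : ∀ k → p (3 + k) ≡ p (2 + k) ++ aca ++ p (1 + k) ++ aca ++ p (2 + k)
p-unfold zero    = refl
p-unfold (suc k) = trans (cong (λ Z → b ∷ aca ++ γ Z) (p-unfold k))
  (cong (λ Z → b ∷ aca ++ Z) (γ-sandwich (p (2 + k)) (p (1 + k))))

aca-palindrome-aca : ∀ {X} → Palindrome X → Palindrome (aca ++ X ++ aca)
aca-palindrome-aca {X} = palindrome-++-mirror {X = aca} {Y = X} refl

p-palindrome : ∀ k → Palindrome (p k)
p-palindrome 0 = refl
p-palindrome 1 = refl
p-palindrome 2 = refl
p-palindrome (suc (suc (suc k))) = subst Palindrome (sym (trans (p-unfold k) regroup))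
  (palindrome-++-mirror (p-palindrome (suc (suc k))) (aca-palindrome-aca (p-palindrome (suc k))))
  where
  regroup : p (2 + k) ++ aca ++ p (1 + k) ++ aca ++ p (2 + k) ≡ p (2 + k) ++ (aca ++ p (1 + k) ++ aca) ++ p (2 + k)
  regroup = cong (λ Z → p (2 + k) ++ aca ++ Z) (sym (++-assoc (p (1 + k)) aca (p (2 + k))))

γ^-ac : ∀ k → γ^ (suc k) (a ∷ c ∷ []) ≡ aca ++ p k
γ^-ac zero    = refl
γ^-ac (suc k) = cong γ (γ^-ac k)

γ^-ab : ∀ k → γ^ (2 + k) (a ∷ b ∷ []) ≡ aca ++ p k ++ aca ++ p (suc k)
γ^-ab zero    = refl
γ^-ab (suc k) = trans (cong γ (γ^-ab k)) (cong (λ Z → aca ++ b ∷ aca ++ Z) (γ-++ (p k) (aca ++ p (suc k))))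

length-aca-aca : ∀ X → length (aca ++ X ++ aca) ≡ suc (length X + 5)
length-aca-aca X = trans (cong (3 +_) (trans (length-++ X) (+-comm (length X) 3)))
                         (cong suc (+-comm 5 (length X)))

γ^-ab-pointOfSymmetry : ∀ k → PointOfSymmetry (γ^ (2 + k) (a ∷ b ∷ [])) (length (p k) + 5)
γ^-ab-pointOfSymmetry k = subst (λ w → PointOfSymmetry w (length (p k) + 5)) (sym factorisation)
  (pointOfSymmetry-++ (aca-palindrome-aca (p-palindrome k)) (p-palindrome (suc k)) (length-aca-aca (p k)))
  where
  factorisation : γ^ (2 + k) (a ∷ b ∷ []) ≡ (aca ++ p k ++ aca) ++ p (suc k)
  factorisation = trans (γ^-ab k) (cong (aca ++_) (sym (++-assoc (p k) aca (p (suc k)))))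

γ^-ac-pointOfSymmetry : ∀ k → PointOfSymmetry (γ^ (suc k) (a ∷ c ∷ [])) 2
γ^-ac-pointOfSymmetry k = subst (λ w → PointOfSymmetry w 2) (sym (γ^-ac k))
  (pointOfSymmetry-++ {P = aca} refl (p-palindrome k) refl)

mainTheorem9 :
    ((k : ℕ) → 2 ≤ k →
      (γ^ k (a ∷ b ∷ []) ≡ (a ∷ c ∷ a ∷ []) ++ p (k ∸ 2) ++ (a ∷ c ∷ a ∷ []) ++ p (k ∸ 1))
      × Symmetric (γ^ k (a ∷ b ∷ []))
      × PointOfSymmetry (γ^ k (a ∷ b ∷ [])) (length (p (k ∸ 2)) + 5))
    ×
    ((k : ℕ) → 1 ≤ k →
      (γ^ k (a ∷ c ∷ []) ≡ (a ∷ c ∷ a ∷ []) ++ p (k ∸ 1))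
      × Symmetric (γ^ k (a ∷ c ∷ []))
      × PointOfSymmetry (γ^ k (a ∷ c ∷ [])) 2)
mainTheorem9 =
  (λ { (suc zero) (s≤s ())
     ; (suc (suc k)) _ → γ^-ab k , (_ , γ^-ab-pointOfSymmetry k) , γ^-ab-pointOfSymmetry k })
  ,
  (λ { zero ()
     ; (suc k) _ → γ^-ac k , (_ , γ^-ac-pointOfSymmetry k) , γ^-ac-pointOfSymmetry k })
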